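{- Let $X$ be a set with two ternary relations $R,S$ and let $(Q,\le,\bullet,\diamond)$ be a bi-prequantale. For each $1\le k\le 7$: if $(RI_k)$ holds in $X$ and $(I_k)$ holds in $Q$, then $(I_k)$ holds in the function space $Q^X$ (ordered pointwise), where $\bullet$ is interpreted as the convolution $\ast$ and $\diamond$ as the convolution $\circledast$.
   Context: $R^x_{yz}$ means the ternary relation $R$ holds at $(x,y,z)$. A bi-prequantale is a complete lattice $(Q,\le)$ with two binary operations $\bullet,\diamond$ each preserving arbitrary sups (including empty sups) in both arguments. Convolutions on $f,g:X\to Q$: $(f\ast g)(x)=\bigvee\{f(y)\bullet g(z)\mid R^x_{yz}\}$, $(f\circledast g)(x)=\bigvee\{f(y)\diamond g(z)\mid S^x_{yz}\}$. Relational interchange laws (for all $t,u,v,w,x\in X$): $(RI_1)$ $R^x_{uv}\Rightarrow S^x_{uv}$; $(RI_2)$ $R^x_{uv}\Rightarrow S^x_{vu}$; $(RI_3)$ $(\exists y.\ R^x_{uy}\wedge S^y_{vw})\Rightarrow(\exists y.\ R^y_{uv}\wedge S^x_{yw})$; $(RI_4)$ $(\exists y.\ S^y_{uv}\wedge R^x_{yw})\Rightarrow(\exists y.\ S^x_{uy}\wedge R^y_{vw})$; $(RI_5)$ $(\exists y.\ R^x_{uy}\wedge S^y_{vw})\Rightarrow(\exists y.\ S^x_{vy}\wedge R^y_{uw})$; $(RI_6)$ $(\exists y.\ S^y_{uv}\wedge R^x_{yw})\Rightarrow(\exists y.\ R^y_{uw}\wedge S^x_{yv})$; $(RI_7)$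 $(\exists y,z.\ S^y_{tu}\wedge R^x_{yz}\wedge S^z_{vw})\Rightarrow(\exists y,z.\ R^y_{tv}\wedge S^x_{yz}\wedge R^z_{uw})$. Algebraic interchange laws (for all $a,b,c,d$): $(I_1)$ $a\bullet b\le a\diamond b$; $(I_2)$ $a\bullet b\le b\diamond a$; $(I_3)$ $a\bullet(b\diamond c)\le(a\bullet b)\diamond c$; $(I_4)$ $(a\diamond b)\bullet c\le a\diamond(b\bullet c)$; $(I_5)$ $a\bullet(b\diamond c)\le b\diamond(a\bullet c)$; $(I_6)$ $(a\diamond b)\bullet c\le(a\bullet c)\diamond b$; $(I_7)$ $(a\diamond b)\bullet(c\diamond d)\le(a\bullet c)\diamond(b\bullet d)$. -}

module Defs where

open import Level using (Level; _⊔_) renaming (suc to lsuc)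
open import Data.Product using (Σ; _×_; _,_; ∃; ∃₂)
open import Data.Fin using (Fin; zero; suc)
open import Relation.Binary.PropositionalEquality using (_≡_)
open import Relation.Binary.Structures using (IsPartialOrder)

record BiPrequantale (c ℓ i : Level) : Set (lsuc (c ⊔ ℓ ⊔ i)) where
  infix 4 _≤_
  infixl 7 _•_ _◇_
  field
    Carrier        : Set c
    _≤_            : Carrier → Carrier → Set ℓ
    isPartialOrder : IsPartialOrder _≡_ _≤_
    ⋁              : {I : Set i} → (I → Carrier) → Carrier
    ⋁-upper        : {I : Set i} (f : I → Carrier) (j : I) → f j ≤ ⋁ f
    ⋁-least        : {I : Set i} (f : I → Carrier) (b : Carrier) →
                     ((j : I) → f j ≤ b) → ⋁ f ≤ b
    _•_            : Carrier → Carrier → Carrier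
    _◇_            : Carrier → Carrier → Carrier
    •-⋁ˡ           : {I : Set i} (f : I → Carrier) (b : Carrier) →
                     ⋁ f • b ≡ ⋁ (λ j → f j • b)
    •-⋁ʳ           : (a : Carrier) {I : Set i} (f : I → Carrier) →
                     a • ⋁ f ≡ ⋁ (λ j → a • f j)
    ◇-⋁ˡ           : {I : Set i} (f : I → Carrier) (b : Carrier) →
                     ⋁ f ◇ b ≡ ⋁ (λ j → f j ◇ b)
    ◇-⋁ʳ           : (a : Carrier) {I : Set i} (f : I → Carrier) →
                     a ◇ ⋁ f ≡ ⋁ (λ j → a ◇ f j)

-- Ternary relation: R x y z  represents  R^x_{yz}.
TernRel : ∀ {i} → Set i → Set (lsuc i)
TernRel {i} X = X → X → X → Set i

convolution : ∀ {c ℓ i} (Q : BiPrequantale c ℓ i) {X : Set i} →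
  TernRel X →
  (BiPrequantale.Carrier Q → BiPrequantale.Carrier Q → BiPrequantale.Carrier Q) →
  (X → BiPrequantale.Carrier Q) → (X → BiPrequantale.Carrier Q) →
  (X → BiPrequantale.Carrier Q)
convolution Q {X} R _∙_ f g x =
  ⋁ {I = Σ (X × X) (λ { (y , z) → R x y z })} (λ { ((y , z) , _) → f y ∙ g z })
  where open BiPrequantale Q

-- The algebraic interchange laws (I_1)..(I_7), for a generic ordered
-- structure (A, ≤, •, ◇).  Index k : Fin 7 stands for law number k+1.
Interchange : ∀ {a ℓ} (k : Fin 7) (A : Set a) (_≤_ : A → A → Set ℓ)
  (_•_ _◇_ : A → A → A) → Set (a ⊔ ℓ)
Interchange zero A _≤_ _•_ _◇_ =
  ∀ a b → (a • b) ≤ (a ◇ b)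
Interchange (suc zero) A _≤_ _•_ _◇_ =
  ∀ a b → (a • b) ≤ (b ◇ a)
Interchange (suc (suc zero)) A _≤_ _•_ _◇_ =
  ∀ a b c → (a • (b ◇ c)) ≤ ((a • b) ◇ c)
Interchange (suc (suc (suc zero))) A _≤_ _•_ _◇_ =
  ∀ a b c → ((a ◇ b) • c) ≤ (a ◇ (b • c))
Interchange (suc (suc (suc (suc zero)))) A _≤_ _•_ _◇_ =
  ∀ a b c → (a • (b ◇ c)) ≤ (b ◇ (a • c))
Interchange (suc (suc (suc (suc (suc zero))))) A _≤_ _•_ _◇_ =
  ∀ a b c → ((a ◇ b) • c) ≤ ((a • c) ◇ b)
Interchange (suc (suc (suc (suc (suc (suc zero)))))) A _≤_ _•_ _◇_ =
  ∀ a b c d → ((a ◇ b) • (c ◇ d)) ≤ ((a • c) ◇ (b • d))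

-- The relational interchange laws (RI_1)..(RI_7).  Index k : Fin 7 stands
-- for law number k+1.
RelInterchange : ∀ {i} (k : Fin 7) {X : Set i} (R S : TernRel X) → Set i
RelInterchange zero R S =
  ∀ x u v → R x u v → S x u v
RelInterchange (suc zero) R S =
  ∀ x u v → R x u v → S x v u
RelInterchange (suc (suc zero)) R S =
  ∀ x u v w → (∃ λ y → R x u y × S y v w) → (∃ λ y → R y u v × S x y w)
RelInterchange (suc (suc (suc zero))) R S =
  ∀ x u v w → (∃ λ y → S y u v × R x y w) → (∃ λ y → S x u y × R y v w)
RelInterchange (suc (suc (suc (suc zero)))) R S =
  ∀ x u v w → (∃ λ y → R x u y × S y v w) → (∃ λ y → S x v y × R y u w)
RelInterchange (suc (suc (suc (suc (suc zero))))) R S =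
  ∀ x u v w → (∃ λ y → S y u v × R x y w) → (∃ λ y → R y u w × S x y v)
RelInterchange (suc (suc (suc (suc (suc (suc zero)))))) R S =
  ∀ x t u v w → (∃₂ λ y z → S y t u × R x y z × S z v w) →
                (∃₂ λ y z → R y t v × S x y z × R z u w)

_≤ᶠ_ : ∀ {c ℓ i} {Q : BiPrequantale c ℓ i} {X : Set i} →
  (X → BiPrequantale.Carrier Q) → (X → BiPrequantale.Carrier Q) → Set (ℓ ⊔ i)
_≤ᶠ_ {Q = Q} f g = ∀ x → BiPrequantale._≤_ Q (f x) (g x)

module Submission where

-- Every law (I_k) compares two (possibly nested) convolutions.  The left
-- side is a join, since • preserves joins in each argument, so it suffices
-- to bound each term of that join.  A single term is of the form
-- f u • (g v ◇ h w) (or similar) indexed by witnesses of R and S; (I_k) in Q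
-- rewrites it into the shape of a term of the right-hand side, and (RI_k)
-- turns the witnesses on the left into witnesses on the right, so the
-- rewritten term is one of the terms joined on the right (up to the
-- monotonicity of ◇).

open import Defs
open import Data.Bool using (Bool; true; false)
open import Data.Fin using (Fin; zero; suc; #_)
open import Data.Product using (_,_)
open import Function using (_∘_)
open import Level using (_⊔_; Lift; lift) renaming (suc to lsuc)
open import Relation.Binary.Bundles using (Poset)
open import Relation.Binary.PropositionalEquality using (_≡_; refl; sym; cong)
import Relation.Binary.Reasoning.PartialOrder as PosetReasoning

module BiPrequantaleProperties {c ℓ i} (Q : BiPrequantale c ℓ i) where
  open BiPrequantale Q

  poset : Poset c c ℓ
  poset = record { isPartialOrder = isPartialOrder }

  open Poset poset public using (antisym; reflexive; trans)
  open PosetReasoning poset public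

  PreservesJoins : (Carrier → Carrier) → Set (c ⊔ lsuc i)
  PreservesJoins φ = {I : Set i} (F : I → Carrier) → φ (⋁ F) ≡ ⋁ (φ ∘ F)

  -- The binary join a ∨ b, realised as a join over a two-element type.
  pair : Carrier → Carrier → Lift i Bool → Carrier
  pair a b (lift true)  = b
  pair a b (lift false) = a

  pair-absorb : ∀ {a b} → a ≤ b → ⋁ (pair a b) ≡ b
  pair-absorb {a} {b} a≤b = antisym
    (⋁-least (pair a b) b λ { (lift true) → reflexive refl ; (lift false) → a≤b })
    (⋁-upper (pair a b) (lift true))

  -- Join-preserving maps are monotone: φ b = φ (a ∨ b) = φ a ∨ φ b ≥ φ a.
  preservesJoins⇒monotone : ∀ {φ a b} → PreservesJoins φ → a ≤ b → φ a ≤ φ b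
  preservesJoins⇒monotone {φ} {a} {b} pres a≤b = begin
    φ a                  ≤⟨ ⋁-upper (φ ∘ pair a b) (lift false) ⟩
    ⋁ (φ ∘ pair a b)     ≡⟨ sym (pres (pair a b)) ⟩
    φ (⋁ (pair a b))     ≡⟨ cong φ (pair-absorb a≤b) ⟩
    φ b                  ∎

  preservesJoins-least : ∀ {φ b} {I : Set i} {F : I → Carrier} →
    PreservesJoins φ → (∀ j → φ (F j) ≤ b) → φ (⋁ F) ≤ b
  preservesJoins-least {φ} {b} {F = F} pres bound = begin
    φ (⋁ F)      ≡⟨ pres F ⟩
    ⋁ (φ ∘ F)    ≤⟨ ⋁-least (φ ∘ F) b bound ⟩
    b            ∎

  ◇-monoˡ : ∀ {a a′} d → a ≤ a′ → a ◇ d ≤ a′ ◇ d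
  ◇-monoˡ d = preservesJoins⇒monotone {φ = _◇ d} (λ F → ◇-⋁ˡ F d)

  ◇-monoʳ : ∀ {a a′} d → a ≤ a′ → d ◇ a ≤ d ◇ a′
  ◇-monoʳ d = preservesJoins⇒monotone {φ = d ◇_} (◇-⋁ʳ d)

  ◇-mono : ∀ {a a′ b b′} → a ≤ a′ → b ≤ b′ → a ◇ b ≤ a′ ◇ b′
  ◇-mono {a′ = a′} {b = b} a≤a′ b≤b′ = trans (◇-monoˡ b a≤a′) (◇-monoʳ a′ b≤b′)

  •-leastˡ : ∀ {b d} {I : Set i} {F : I → Carrier} →
    (∀ j → F j • d ≤ b) → ⋁ F • d ≤ b
  •-leastˡ {d = d} = preservesJoins-least {φ = _• d} (λ F → •-⋁ˡ F d)

  •-leastʳ : ∀ {a b} {I : Set i} {F : I → Carrier} →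
    (∀ j → a • F j ≤ b) → a • ⋁ F ≤ b
  •-leastʳ {a} = preservesJoins-least {φ = a •_} (•-⋁ʳ a)

module Convolutions {c ℓ i} (Q : BiPrequantale c ℓ i) {X : Set i}
  (R S : TernRel X) where
  open BiPrequantale Q
  open BiPrequantaleProperties Q

  infixl 7 _⋆_ _⊛_

  _⋆_ : (X → Carrier) → (X → Carrier) → X → Carrier
  _⋆_ = convolution Q R _•_

  _⊛_ : (X → Carrier) → (X → Carrier) → X → Carrier
  _⊛_ = convolution Q S _◇_

  ⋆-upper : ∀ {f g x y z} → R x y z → f y • g z ≤ (f ⋆ g) x
  ⋆-upper {y = y} {z} r = ⋁-upper _ ((y , z) , r)

  ⊛-upper : ∀ {f g x y z} → S x y z → f y ◇ g z ≤ (f ⊛ g) x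
  ⊛-upper {y = y} {z} s = ⋁-upper _ ((y , z) , s)

  ⋆-least : ∀ {f g x b} → (∀ {y z} → R x y z → f y • g z ≤ b) → (f ⋆ g) x ≤ b
  ⋆-least bound = ⋁-least _ _ λ { ((y , z) , r) → bound r }

  -- Lower-side bounds: a nested convolution with ⋆ outside is below b as
  -- soon as every product of values at compatible witnesses is, because •
  -- distributes over the inner join.
  ⋆⊛-least : ∀ {f g h x b} →
    (∀ {u y v w} → R x u y → S y v w → f u • (g v ◇ h w) ≤ b) →
    (f ⋆ (g ⊛ h)) x ≤ b
  ⋆⊛-least bound = ⋆-least λ r →
    •-leastʳ λ { ((v , w) , s) → bound r s }

  ⊛⋆-least : ∀ {f g h x b} →
    (∀ {u v y w} → S y u v → R x y w → (f u ◇ g v) • h w ≤ b) →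
    ((f ⊛ g) ⋆ h) x ≤ b
  ⊛⋆-least bound = ⋆-least λ r →
    •-leastˡ λ { ((u , v) , s) → bound s r }

  ⊛⋆⊛-least : ∀ {f g h k x b} →
    (∀ {t u y z v w} → S y t u → R x y z → S z v w →
      (f t ◇ g u) • (h v ◇ k w) ≤ b) →
    ((f ⊛ g) ⋆ (h ⊛ k)) x ≤ b
  ⊛⋆⊛-least bound = ⋆-least λ r →
    •-leastˡ λ { ((t , u) , s₁) →
    •-leastʳ λ { ((v , w) , s₂) → bound s₁ r s₂ } }

  ⋆⊛ˡ-upper : ∀ {f g h x y u v w} → R y u v → S x y w →
    (f u • g v) ◇ h w ≤ ((f ⋆ g) ⊛ h) x
  ⋆⊛ˡ-upper {h = h} {w = w} r s =
    trans (◇-monoˡ (h w) (⋆-upper r)) (⊛-upper s)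

  ⋆⊛ʳ-upper : ∀ {f g h x y u v w} → S x u y → R y v w →
    f u ◇ (g v • h w) ≤ (f ⊛ (g ⋆ h)) x
  ⋆⊛ʳ-upper {f = f} {u = u} s r =
    trans (◇-monoʳ (f u) (⋆-upper r)) (⊛-upper s)

  ⋆⊛⋆-upper : ∀ {f g h k x y z t u v w} →
    R y t v → S x y z → R z u w →
    (f t • h v) ◇ (g u • k w) ≤ ((f ⋆ h) ⊛ (g ⋆ k)) x
  ⋆⊛⋆-upper r₁ s r₂ =
    trans (◇-mono (⋆-upper r₁) (⋆-upper r₂)) (⊛-upper s)

  Lifts : Fin 7 → Set (c ⊔ ℓ ⊔ i)
  Lifts k = RelInterchange k R S → Interchange k Carrier _≤_ _•_ _◇_ →
            Interchange k (X → Carrier) (_≤ᶠ_ {Q = Q}) _⋆_ _⊛_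

  interchange₁-lifts : Lifts (# 0)
  interchange₁-lifts ri law f g x = ⋆-least λ {y} {z} r →
    trans (law (f y) (g z)) (⊛-upper (ri x y z r))

  interchange₂-lifts : Lifts (# 1)
  interchange₂-lifts ri law f g x = ⋆-least λ {y} {z} r →
    trans (law (f y) (g z)) (⊛-upper (ri x y z r))

  interchange₃-lifts : Lifts (# 2)
  interchange₃-lifts ri law f g h x = ⋆⊛-least λ {u} {y} {v} {w} r s →
    let (_ , r′ , s′) = ri x u v w (y , r , s)
    in trans (law (f u) (g v) (h w)) (⋆⊛ˡ-upper r′ s′)

  interchange₄-lifts : Lifts (# 3)
  interchange₄-lifts ri law f g h x = ⊛⋆-least λ {u} {v} {y} {w} s r →
    let (_ , s′ , r′) = ri x u v w (y , s , r)
    in trans (law (f u) (g v) (h w)) (⋆⊛ʳ-upper s′ r′)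

  interchange₅-lifts : Lifts (# 4)
  interchange₅-lifts ri law f g h x = ⋆⊛-least λ {u} {y} {v} {w} r s →
    let (_ , s′ , r′) = ri x u v w (y , r , s)
    in trans (law (f u) (g v) (h w)) (⋆⊛ʳ-upper s′ r′)

  interchange₆-lifts : Lifts (# 5)
  interchange₆-lifts ri law f g h x = ⊛⋆-least λ {u} {v} {y} {w} s r →
    let (_ , r′ , s′) = ri x u v w (y , s , r)
    in trans (law (f u) (g v) (h w)) (⋆⊛ˡ-upper r′ s′)

  interchange₇-lifts : Lifts (# 6)
  interchange₇-lifts ri law f g h k x =
    ⊛⋆⊛-least λ {t} {u} {y} {z} {v} {w} s₁ r s₂ →
      let (_ , _ , r₁ , s′ , r₂) = ri x t u v w (y , z , s₁ , r , s₂)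
      in trans (law (f t) (g u) (h v) (k w)) (⋆⊛⋆-upper r₁ s′ r₂)

  lifts : ∀ k → Lifts k
  lifts zero                                     = interchange₁-lifts
  lifts (suc zero)                               = interchange₂-lifts
  lifts (suc (suc zero))                         = interchange₃-lifts
  lifts (suc (suc (suc zero)))                   = interchange₄-lifts
  lifts (suc (suc (suc (suc zero))))             = interchange₅-lifts
  lifts (suc (suc (suc (suc (suc zero)))))       = interchange₆-lifts
  lifts (suc (suc (suc (suc (suc (suc zero)))))) = interchange₇-lifts

proposition3p4 : ∀ {c ℓ i} (Q : BiPrequantale c ℓ i) (X : Set i) (R S : TernRel X)
    (k : Fin 7) →
    RelInterchange k R S →
    Interchange k (BiPrequantale.Carrier Q) (BiPrequantale._≤_ Q)
      (BiPrequantale._•_ Q) (BiPrequantale._◇_ Q) →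
    Interchange k (X → BiPrequantale.Carrier Q) (_≤ᶠ_ {Q = Q})
      (convolution Q R (BiPrequantale._•_ Q)) (convolution Q S (BiPrequantale._◇_ Q))
proposition3p4 Q X R S = Convolutions.lifts Q R S
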